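{- Let $G\subseteq K_{m,r+1}$ be a bipartite graph with left vertices $1,\dots,m$ and right vertices $0',1',\dots,r'$ and no isolated vertices, and let $T,T'$ be spanning trees of $G$ with left degree vectors $(d_1,\dots,d_m)$ and $(d'_1,\dots,d'_m)$. Suppose there are distinct left vertices $u,w$ such that $d_w<d'_w$, $d_u>d'_u$, $d_i\geq d'_i$ for all $i\neq w$, $0'$ is adjacent to both $u$ and $w$ in $T'$, and $0'$ is adjacent to $w$ in $T$. Then $T$ and $T'$ are incompatible.
   Context: The left degree vector of a spanning tree $T$ is $(d_1,\dots,d_m)$ with $d_i=\deg_T(i)-1$. $U(T,T')$ is the directed graph on the vertices of $G$ whose arcs are the edges of $T$ oriented from left to right together with the edges of $T'$ oriented from right to left. A directed cycle is a sequence of arcs $(i_1,i_2),\dots,(i_{k-1},i_k),(i_k,i_1)$ with $i_1,\dots,i_k$ distinct. $T$ and $T'$ are compatible if $U(T,T')$ has no directed cycle of length $\geq 4$, and incompatible otherwise. -}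

module Defs where

open import Data.Nat using (ℕ; suc; _≥_)
open import Data.Integer using (ℤ; +_; _-_; 1ℤ)
open import Data.Fin using (Fin)
open import Data.Bool using (Bool; true; if_then_else_)
open import Data.Sum using (_⊎_; inj₁; inj₂)
open import Data.Product using (Σ; _×_; ∃)
open import Data.Empty using (⊥)
open import Data.List using (List; []; _∷_; _++_; [_]; length; map; allFin)
open import Data.Nat.ListAction using (sum)
open import Data.List.Relation.Unary.Linked using (Linked)
open import Data.List.Relation.Unary.Unique.Propositional using (Unique)
open import Relation.Nullary using (¬_)
open import Relation.Binary.PropositionalEquality using (_≡_)

-- A bipartite graph G ⊆ K_{m,r+1}: left vertices Fin m (= 1..m),
-- right vertices Fin (suc r) (= 0',1',…,r', with 0' = Fin.zero).
-- An edge set is a Boolean adjacency matrix.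
BipGraph : ℕ → ℕ → Set
BipGraph m r = Fin m → Fin (suc r) → Bool

Vertex : ℕ → ℕ → Set
Vertex m r = Fin m ⊎ Fin (suc r)

Adj : ∀ {m r} → BipGraph m r → Vertex m r → Vertex m r → Set
Adj E (inj₁ i) (inj₂ j) = E i j ≡ true
Adj E (inj₂ j) (inj₁ i) = E i j ≡ true
Adj E (inj₁ _) (inj₁ _) = ⊥
Adj E (inj₂ _) (inj₂ _) = ⊥

data Walk {V : Set} (R : V → V → Set) : V → V → Set where
  here : ∀ {x} → Walk R x x
  step : ∀ {x y z} → R x y → Walk R y z → Walk R x z

HasCycle≥ : {V : Set} → ℕ → (V → V → Set) → Set
HasCycle≥ {V} k R = Σ V λ v → Σ (List V) λ vs →
  (length (v ∷ vs) ≥ k) × Unique (v ∷ vs) × Linked R ((v ∷ vs) ++ [ v ])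

_⊆G_ : ∀ {m r} → BipGraph m r → BipGraph m r → Set
T ⊆G G = ∀ i j → T i j ≡ true → G i j ≡ true

Connected : ∀ {m r} → BipGraph m r → Set
Connected E = ∀ x y → Walk (Adj E) x y

-- acyclic: no (simple, undirected) cycle, i.e. of length ≥ 3
Acyclic : ∀ {m r} → BipGraph m r → Set
Acyclic E = ¬ HasCycle≥ 3 (Adj E)

IsSpanningTree : ∀ {m r} → BipGraph m r → BipGraph m r → Set
IsSpanningTree G T = (T ⊆G G) × Connected T × Acyclic T

NoIsolated : ∀ {m r} → BipGraph m r → Set
NoIsolated G = ∀ x → ∃ λ y → Adj G x y

degL : ∀ {m r} → BipGraph m r → Fin m → ℕ
degL {m} {r} T i = sum (map (λ j → if T i j then 1 else 0) (allFin (suc r)))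

leftDeg : ∀ {m r} → BipGraph m r → Fin m → ℤ
leftDeg T i = + degL T i - 1ℤ

-- directed graph U(T,T'): T-edges left→right, T'-edges right→left
Arc : ∀ {m r} → BipGraph m r → BipGraph m r → Vertex m r → Vertex m r → Set
Arc T T' (inj₁ i) (inj₂ j) = T i j ≡ true
Arc T T' (inj₂ j) (inj₁ i) = T' i j ≡ true
Arc T T' (inj₁ _) (inj₁ _) = ⊥
Arc T T' (inj₂ _) (inj₂ _) = ⊥

Incompatible : ∀ {m r} → BipGraph m r → BipGraph m r → Set
Incompatible T T' = HasCycle≥ 4 (Arc T T')

module Submission where

-- Let X be the set of
-- vertices reachable from u in U(T,T') avoiding w and 0', and L its left part
-- (u ∈ L, w ∉ L).  If a right vertex j ∈ X is a T'-neighbour of w, then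
-- w → 0' → u ⇝ j → w is a directed cycle of length ≥ 4.  Otherwise X is closed
-- under T'-arcs and under T-arcs not entering 0'.  Rooting both trees at 0', the
-- edges to the parent inject X into the T'-edges at L, so |X| ≤ Σ_L deg_T'; and as
-- every edge of a tree is a parent edge, the T-edges at L together with w0' are
-- determined by their children, which lie in {w} ∪ X, so Σ_L deg_T ≤ |X|.

open import Defs
open import Data.Bool using (Bool; true; false; if_then_else_)
import Data.Bool as Bool
open import Data.Empty using (⊥; ⊥-elim)
open import Data.Fin as Fin using (Fin; zero; suc)
open import Data.Integer using (+_; 1ℤ)
import Data.Integer as ℤ
open import Data.List using (List; []; _∷_; _++_; [_]; length; map; reverse; filter; allFin)
open import Data.List.Properties using (length-++; length-map; length-reverse; unfold-reverse; reverse-++; ++-assoc; ∷-injectiveˡ; ∷-injectiveʳ)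
open import Data.List.Membership.Propositional using (_∈_; _∉_; lose; find)
open import Data.List.Membership.Propositional.Properties using (∈-++⁺ˡ; ∈-++⁺ʳ; ∈-++⁻; ∈-∃++; ∈-map⁺; ∈-map⁻; ∈-filter⁺; ∈-filter⁻; ∈-allFin)
open import Data.List.Relation.Unary.All as All using (All; []; _∷_)
open import Data.List.Relation.Unary.All.Properties using (All¬⇒¬Any; ¬Any⇒All¬)
open import Data.List.Relation.Unary.Any using (Any; here; there; any?; satisfied)
open import Data.List.Relation.Unary.Any.Properties using (reverse⁺; reverse⁻)
open import Data.List.Relation.Unary.AllPairs using ([]; _∷_)
open import Data.List.Relation.Unary.Linked as Linked using (Linked; []; [-]; _∷_)
open import Data.List.Relation.Unary.Unique.Propositional using (Unique)
import Data.List.Relation.Unary.Unique.Propositional.Properties as Unique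
open import Data.Nat.ListAction using (sum)
open import Data.Nat using (ℕ; zero; suc; _+_; _≤_; _<_; _≥_; _≤′_; ≤′-refl; ≤′-step; z≤n; s≤s; s≤s⁻¹)
open import Data.Nat.Properties using (+-suc; ≤⇒≤′; ≮⇒≥; ≤-refl; ≤-trans; <⇒≤; <-asym; <-irrefl; ≤-<-trans; <-≤-trans; m≤n+m; n≤0⇒n≡0; +-identityʳ; +-mono-≤; module ≤-Reasoning)
open import Data.Product using (Σ; _×_; _,_; proj₁; proj₂)
open import Data.Sum using (_⊎_; inj₁; inj₂; [_,_]′)
open import Data.Sum.Properties using (inj₁-injective; ≡-dec)
open import Function using (flip; _∘_; case_of_)
open import Relation.Binary.Definitions using (DecidableEquality)
open import Relation.Binary.PropositionalEquality using (_≡_; _≢_; refl; sym; trans; cong; cong₂; subst; module ≡-Reasoning)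
open import Relation.Nullary using (¬_; Dec; yes; no)
open import Relation.Nullary.Decidable using (_×-dec_; _⊎-dec_; ¬?)

private
  variable
    A B : Set

∈-delete : ∀ {z x : A} (xs ys : List A) → z ∈ xs ++ x ∷ ys → z ≢ x → z ∈ xs ++ ys
∈-delete []       ys (here z≡x)  z≢x = ⊥-elim (z≢x z≡x)
∈-delete []       ys (there z∈)  _   = z∈
∈-delete (_ ∷ xs) ys (here z≡y)  _   = here z≡y
∈-delete (_ ∷ xs) ys (there z∈)  z≢x = there (∈-delete xs ys z∈ z≢x)

unique⊆⇒length≤ : {xs ys : List A} → Unique xs → (∀ {x} → x ∈ xs → x ∈ ys) → length xs ≤ length ys
unique⊆⇒length≤ {xs = []}     _            _   = z≤n
unique⊆⇒length≤ {xs = x ∷ xs} {ys} (x∉xs ∷ uxs) xs⊆ys with ∈-∃++ (xs⊆ys (here refl))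
... | before , after , ys≡ = subst (suc (length xs) ≤_) (sym length-ys) (s≤s (unique⊆⇒length≤ uxs xs⊆rest))
  where
  open ≡-Reasoning
  xs⊆rest : ∀ {z} → z ∈ xs → z ∈ before ++ after
  xs⊆rest {z} z∈xs = ∈-delete before after (subst (z ∈_) ys≡ (xs⊆ys (there z∈xs)))
                       (λ z≡x → All¬⇒¬Any x∉xs (subst (_∈ xs) z≡x z∈xs))
  length-ys : length ys ≡ suc (length (before ++ after))
  length-ys = begin
    length ys                          ≡⟨ cong length ys≡ ⟩
    length (before ++ x ∷ after)       ≡⟨ length-++ before ⟩
    length before + suc (length after) ≡⟨ +-suc (length before) (length after) ⟩
    suc (length before + length after) ≡⟨ cong suc (sym (length-++ before)) ⟩
    suc (length (before ++ after))     ∎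

map-unique-on : (f : A → B) {xs : List A} → Unique xs →
                (∀ {x y} → x ∈ xs → y ∈ xs → f x ≡ f y → x ≡ y) → Unique (map f xs)
map-unique-on f {[]}     _            _   = []
map-unique-on f {x ∷ xs} (x∉xs ∷ uxs) inj =
  ¬Any⇒All¬ (map f xs) fx∉ ∷ map-unique-on f uxs (λ p q → inj (there p) (there q))
  where
  fx∉ : f x ∉ map f xs
  fx∉ fx∈ with ∈-map⁻ f fx∈
  ... | y , y∈xs , fx≡fy = All¬⇒¬Any x∉xs (subst (_∈ xs) (sym (inj (here refl) (there y∈xs) fx≡fy)) y∈xs)

injection⇒length≤ : (f : A → B) {xs : List A} {ys : List B} → Unique xs →
                    (∀ {x y} → x ∈ xs → y ∈ xs → f x ≡ f y → x ≡ y) →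
                    (∀ {x} → x ∈ xs → f x ∈ ys) → length xs ≤ length ys
injection⇒length≤ f {xs} {ys} uxs inj into =
  subst (_≤ length ys) (length-map f xs) (unique⊆⇒length≤ (map-unique-on f uxs inj) image⊆)
  where
  image⊆ : ∀ {z} → z ∈ map f xs → z ∈ ys
  image⊆ z∈ with ∈-map⁻ f z∈
  ... | x , x∈xs , refl = into x∈xs

unique-prefix : (xs : List A) {ys : List A} → Unique (xs ++ ys) → Unique xs
unique-prefix []       _            = []
unique-prefix (x ∷ xs) (x∉ ∷ uxys) = ¬Any⇒All¬ xs (λ x∈xs → All¬⇒¬Any x∉ (∈-++⁺ˡ x∈xs)) ∷ unique-prefix xs uxys

unique-middle : (xs : List A) {c : A} {ys : List A} → Unique (xs ++ c ∷ ys) → c ∉ xs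
unique-middle (x ∷ xs) (x∉ ∷ _)   (here refl) = All¬⇒¬Any x∉ (∈-++⁺ʳ xs (here refl))
unique-middle (x ∷ xs) (_ ∷ uxcy) (there c∈)  = unique-middle xs uxcy c∈

unique-reverse : {xs : List A} → Unique xs → Unique (reverse xs)
unique-reverse {xs = []}     _            = []
unique-reverse {xs = x ∷ xs} (x∉xs ∷ uxs) = subst Unique (sym (unfold-reverse x xs))
  (Unique.++⁺ (unique-reverse uxs) ([] ∷ []) λ { (x∈ , here refl) → All¬⇒¬Any x∉xs (reverse⁻ x∈) })

linked-join : {R : A → A → Set} (xs : List A) {a b : A} {ys : List A} →
              Linked R (xs ++ [ a ]) → R a b → Linked R (b ∷ ys) → Linked R ((xs ++ [ a ]) ++ b ∷ ys)
linked-join []           _          r l = r ∷ l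
linked-join (x ∷ [])     (r′ ∷ _)  r l = r′ ∷ r ∷ l
linked-join (x ∷ y ∷ xs) (r′ ∷ l′) r l = r′ ∷ linked-join (y ∷ xs) l′ r l

linked-prefix : {R : A → A → Set} (xs : List A) {c : A} {ys : List A} → Linked R (xs ++ c ∷ ys) → Linked R (xs ++ [ c ])
linked-prefix []           _        = [-]
linked-prefix (x ∷ [])     (r ∷ _) = r ∷ [-]
linked-prefix (x ∷ y ∷ xs) (r ∷ l) = r ∷ linked-prefix (y ∷ xs) l

linked-reverse : {R : A → A → Set} {xs : List A} → Linked R xs → Linked (flip R) (reverse xs)
linked-reverse []  = []
linked-reverse [-] = [-]
linked-reverse {R = R} {x ∷ y ∷ xs} (r ∷ l) =
  subst (Linked (flip R)) (sym (trans (unfold-reverse x (y ∷ xs)) (cong (_++ [ x ]) (unfold-reverse y xs))))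
    (linked-join (reverse xs) (subst (Linked (flip R)) (unfold-reverse y xs) (linked-reverse l)) r [-])

-- A cycle of the reversed relation, read backwards, is a cycle of the relation.
-- Paths found by search are recorded newest-first, so cycles built from them are
-- naturally cycles of flip R.
cycle-flip : {R : A → A → Set} (k : ℕ) → HasCycle≥ k (flip R) → HasCycle≥ k R
cycle-flip {R = R} k (v , vs , long , v∉vs ∷ uvs , linked) =
  v , reverse vs , subst (λ n → suc n ≥ k) (sym (length-reverse vs)) long ,
  ¬Any⇒All¬ (reverse vs) (λ v∈ → All¬⇒¬Any v∉vs (reverse⁻ v∈)) ∷ unique-reverse uvs ,
  subst (Linked R) (reverse-of-cycle) (linked-reverse linked)
  where
  reverse-of-cycle : reverse (v ∷ vs ++ [ v ]) ≡ v ∷ reverse vs ++ [ v ]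
  reverse-of-cycle = trans (unfold-reverse v (vs ++ [ v ])) (cong (_++ [ v ]) (reverse-++ vs [ v ]))

split-at-first : {P : A → Set} → (∀ x → Dec (P x)) → {xs : List A} → Any P xs →
                 Σ (List A) λ before → Σ A λ c → Σ (List A) λ after →
                 (xs ≡ before ++ c ∷ after) × All (λ z → ¬ P z) before × P c
split-at-first P? {x ∷ xs} any with P? x
... | yes px = [] , x , xs , refl , [] , px
split-at-first P? {x ∷ xs} (here px)  | no ¬px = ⊥-elim (¬px px)
split-at-first P? {x ∷ xs} (there any) | no ¬px with split-at-first P? any
... | before , c , after , xs≡ , ¬Pbefore , pc = x ∷ before , c , after , cong (x ∷_) xs≡ , ¬px ∷ ¬Pbefore , pc

-- For T' this gives an injection of the
-- non-root vertices into the edges (v ↦ edge to its parent); the submodule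
-- Acyclic shows that when R is an acyclic graph every edge arises this way.
module Rooted {V : Set} (_≟_ : DecidableEquality V) (vertices : List V) (complete : ∀ v → v ∈ vertices)
              (R : V → V → Set) (R? : ∀ x y → Dec (R x y)) (ρ : V) (reachable : ∀ v → Walk R ρ v) where

  Within : ℕ → V → Set
  Within zero    v = v ≡ ρ
  Within (suc k) v = Within k v ⊎ Any (λ y → Within k y × R y v) vertices

  within? : ∀ k v → Dec (Within k v)
  within? zero    v = v ≟ ρ
  within? (suc k) v = within? k v ⊎-dec any? (λ y → within? k y ×-dec R? y v) vertices

  within-mono : ∀ {j k v} → j ≤′ k → Within j v → Within k v
  within-mono ≤′-refl        wv = wv
  within-mono (≤′-step j≤k) wv = inj₁ (within-mono j≤k wv)

  walk⇒within : ∀ {k x v} → Walk R x v → Within k x → Σ ℕ λ n → Within n v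
  walk⇒within here           wx = _ , wx
  walk⇒within (step {x = x} r walk) wx = walk⇒within walk (inj₂ (lose (complete x) (wx , r)))

  Least : V → Set
  Least v = Σ ℕ λ d → Within d v × (∀ {j} → j < d → ¬ Within j v)

  least-from : ∀ {v} n → Within n v → Least v
  least-from     zero    wv = zero , wv , λ ()
  least-from {v} (suc n) wv with within? n v
  ... | yes wn  = least-from n wn
  ... | no  ¬wn = suc n , wv , λ j<1+n wj → ¬wn (within-mono (≤⇒≤′ (s≤s⁻¹ j<1+n)) wj)

  least : ∀ v → Least v
  least v = let n , wn = walk⇒within (reachable v) refl in least-from n wn

  depth : V → ℕ
  depth v = proj₁ (least v)

  depth-root : ∀ {v} → depth v ≡ 0 → v ≡ ρ
  depth-root {v} d≡0 = subst (λ d → Within d v) d≡0 (proj₁ (proj₂ (least v)))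

  depth-≤ : ∀ {j v} → Within j v → depth v ≤ j
  depth-≤ {v = v} wj = ≮⇒≥ λ j<d → proj₂ (proj₂ (least v)) j<d wj

  parent-exists : ∀ v → v ≢ ρ → Σ V λ y → R y v × depth y < depth v
  parent-exists v v≢ρ with least v
  ... | zero  , v≡ρ      , _   = ⊥-elim (v≢ρ v≡ρ)
  ... | suc k , inj₁ wk  , min = ⊥-elim (min ≤-refl wk)
  ... | suc k , inj₂ any , _   = let y , wy , r = satisfied any in y , r , s≤s (depth-≤ wy)

  -- The parent of a non-root vertex (the root is its own parent).
  par : V → V
  par v with v ≟ ρ
  ... | yes _   = ρ
  ... | no  v≢ρ = proj₁ (parent-exists v v≢ρ)

  par-adjacent : ∀ {v} → v ≢ ρ → R (par v) v
  par-adjacent {v} v≢ρ with v ≟ ρ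
  ... | yes v≡ρ = ⊥-elim (v≢ρ v≡ρ)
  ... | no  v≢ρ′ = proj₁ (proj₂ (parent-exists v v≢ρ′))

  par-depth : ∀ {v} → v ≢ ρ → depth (par v) < depth v
  par-depth {v} v≢ρ with v ≟ ρ
  ... | yes v≡ρ = ⊥-elim (v≢ρ v≡ρ)
  ... | no  v≢ρ′ = proj₂ (proj₂ (parent-exists v v≢ρ′))

  -- Two vertices are never each other's parents: depths would decrease both ways.
  no-parent-swap : ∀ {x y} → x ≢ ρ → y ≢ ρ → par x ≡ y → par y ≡ x → ⊥
  no-parent-swap {x} {y} x≢ρ y≢ρ px≡y py≡x =
    <-asym (subst (λ z → depth z < depth x) px≡y (par-depth x≢ρ))
           (subst (λ z → depth z < depth y) py≡x (par-depth y≢ρ))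

  -- chain n v: the parent chain v, par v, par (par v), … stopped at the root or
  -- after n steps.  (The root test is written ρ ≟ v, so that it is independent
  -- of the test v ≟ ρ performed inside par.)
  chain : ℕ → V → List V
  chain zero    v = [ v ]
  chain (suc n) v with ρ ≟ v
  ... | yes _ = [ v ]
  ... | no  _ = v ∷ chain n (par v)

  chain-head : ∀ n v → Σ (List V) λ rest → chain n v ≡ v ∷ rest
  chain-head zero    v = [] , refl
  chain-head (suc n) v with ρ ≟ v
  ... | yes _ = [] , refl
  ... | no  _ = chain n (par v) , refl

  chain-second : ∀ n {v y rest} → chain n v ≡ v ∷ y ∷ rest → v ≢ ρ × par v ≡ y
  chain-second (suc n) {v} eq with ρ ≟ v
  chain-second (suc n) {v} () | yes _
  ... | no ρ≢v with chain-head n (par v)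
  ...   | _ , eq′ = ρ≢v ∘ sym , ∷-injectiveˡ (trans (sym eq′) (∷-injectiveʳ eq))

  root∈chain : ∀ n v → depth v ≤ n → ρ ∈ chain n v
  root∈chain zero    v d≤0 = here (sym (depth-root (n≤0⇒n≡0 d≤0)))
  root∈chain (suc n) v d≤1+n with ρ ≟ v
  ... | yes ρ≡v = here ρ≡v
  ... | no  ρ≢v = there (root∈chain n (par v) (s≤s⁻¹ (<-≤-trans (par-depth (ρ≢v ∘ sym)) d≤1+n)))

  -- Depths along the chain of v are at most depth v; as par decreases depth, the
  -- chain has no repetitions.
  chain-depth : ∀ n v → All (λ x → depth x ≤ depth v) (chain n v)
  chain-depth zero    v = ≤-refl ∷ []
  chain-depth (suc n) v with ρ ≟ v
  ... | yes _   = ≤-refl ∷ []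
  ... | no  ρ≢v = ≤-refl ∷ All.map (λ d≤ → ≤-trans d≤ (<⇒≤ (par-depth (ρ≢v ∘ sym)))) (chain-depth n (par v))

  chain-unique : ∀ n v → Unique (chain n v)
  chain-unique zero    v = [] ∷ []
  chain-unique (suc n) v with ρ ≟ v
  ... | yes _   = [] ∷ []
  ... | no  ρ≢v = All.map below-v (chain-depth n (par v)) ∷ chain-unique n (par v)
    where
    below-v : ∀ {x} → depth x ≤ depth (par v) → v ≢ x
    below-v d≤ v≡x = <-irrefl (cong depth (sym v≡x)) (≤-<-trans d≤ (par-depth (ρ≢v ∘ sym)))

  chain-linked : ∀ n v → Linked (flip R) (chain n v)
  chain-linked zero    v = [-]
  chain-linked (suc n) v with ρ ≟ v
  ... | yes _   = [-]
  ... | no  ρ≢v with chain n (par v) | chain-head n (par v) | chain-linked n (par v)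
  ...   | .(par v ∷ rest) | rest , refl | linked = par-adjacent (ρ≢v ∘ sym) ∷ linked

  module Acyclic (R-sym : ∀ {x y} → R x y → R y x) (R-irrefl : ∀ {x} → ¬ R x x) (acyclic : ¬ HasCycle≥ 3 R) where

    open import Data.List.Membership.DecPropositional _≟_ using (_∈?_)

    rootPath : V → List V
    rootPath v = chain (depth v) v

    rootPath-linked : ∀ v → Linked R (rootPath v)
    rootPath-linked v = Linked.map R-sym (chain-linked (depth v) v)

    join-at : (B : List V) {c y x : V} {rest : List V} →
              Linked R (c ∷ reverse (y ∷ B)) → R y x → Linked R (x ∷ rest) → Linked R (c ∷ reverse (y ∷ B) ++ x ∷ rest)
    join-at B {c} {y} {x} {rest} l r l′ = subst (λ zs → Linked R (c ∷ zs ++ x ∷ rest)) (sym (unfold-reverse y B))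
      (linked-join (c ∷ reverse B) (subst (λ zs → Linked R (c ∷ zs)) (unfold-reverse y B) l) r l′)

    -- If the root paths of x and y first meet at c, so that they read A ++ c ∷ _
    -- and B ++ c ∷ _ with A disjoint from the root path of y, then c, reverse B, A is
    -- a cycle (closed by an edge y–x, supplied by the caller as the gluing function)
    -- as soon as it has at least three vertices.
    meet-cycle : ∀ {x y} (A B : List V) {c : V} {ax by : List V} →
                 rootPath x ≡ A ++ c ∷ ax → rootPath y ≡ B ++ c ∷ by → All (_∉ rootPath y) A →
                 3 ≤ suc (length B + length A) →
                 (Linked R (c ∷ reverse B) → Linked R (A ++ [ c ]) → Linked R (c ∷ reverse B ++ A ++ [ c ])) →
                 HasCycle≥ 3 R
    meet-cycle {x} {y} A B {c} {ax} {by} x≡ y≡ A∩y=∅ long join =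
      c , reverse B ++ A , subst (λ k → 3 ≤ suc k) (sym length-cycle) long , c∉ ∷ unique-cycle ,
      subst (Linked R) (cong (c ∷_) (sym (++-assoc (reverse B) A [ c ]))) (join linked-B linked-A)
      where
      unique-x : Unique (A ++ c ∷ ax)
      unique-x = subst Unique x≡ (chain-unique (depth x) x)
      unique-y : Unique (B ++ c ∷ by)
      unique-y = subst Unique y≡ (chain-unique (depth y) y)
      linked-A : Linked R (A ++ [ c ])
      linked-A = linked-prefix A (subst (Linked R) x≡ (rootPath-linked x))
      linked-B : Linked R (c ∷ reverse B)
      linked-B = Linked.map R-sym (subst (Linked (flip R)) (reverse-++ B [ c ])
                   (linked-reverse (linked-prefix B (subst (Linked R) y≡ (rootPath-linked y)))))
      length-cycle : length (reverse B ++ A) ≡ length B + length A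
      length-cycle = trans (length-++ (reverse B)) (cong (_+ length A) (length-reverse B))
      c∉ : All (c ≢_) (reverse B ++ A)
      c∉ = ¬Any⇒All¬ (reverse B ++ A) λ c∈ → [ unique-middle B unique-y ∘ reverse⁻ , unique-middle A unique-x ]′ (∈-++⁻ (reverse B) c∈)
      unique-cycle : Unique (reverse B ++ A)
      unique-cycle = Unique.++⁺ (unique-reverse (unique-prefix B unique-y)) (unique-prefix A unique-x)
        λ {z} (z∈B , z∈A) → All.lookup A∩y=∅ z∈A (subst (z ∈_) (sym y≡) (∈-++⁺ˡ (reverse⁻ {xs = B} z∈B)))

    -- An edge x–y that is not a parent edge in either direction yields a cycle;
    -- the short cases where the meeting point is x or y are exactly parent edges.
    cycle-from-edge : ∀ {x y} → R x y → ¬ (x ≢ ρ × par x ≡ y) → ¬ (y ≢ ρ × par y ≡ x) →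
                      (A B : List V) {c : V} {ax by rx ry : List V} →
                      x ∷ rx ≡ A ++ c ∷ ax → rootPath x ≡ A ++ c ∷ ax →
                      y ∷ ry ≡ B ++ c ∷ by → rootPath y ≡ B ++ c ∷ by →
                      All (_∉ rootPath y) A → HasCycle≥ 3 R
    cycle-from-edge r _ _ [] [] refl _ refl _ _ = ⊥-elim (R-irrefl r)
    cycle-from-edge {y = y} r _ ¬y→x [] (_ ∷ []) refl _ refl y≡ _ = ⊥-elim (¬y→x (chain-second (depth y) y≡))
    cycle-from-edge {x = x} r ¬x→y _ (_ ∷ []) [] refl x≡ refl _ _ = ⊥-elim (¬x→y (chain-second (depth x) x≡))
    cycle-from-edge r _ _ [] (_ ∷ b ∷ B) refl x≡ refl y≡ A∩y=∅ =
      meet-cycle [] (_ ∷ b ∷ B) x≡ y≡ A∩y=∅ (s≤s (s≤s (s≤s z≤n))) (λ LB LA → join-at (b ∷ B) LB (R-sym r) LA)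
    cycle-from-edge r _ _ (_ ∷ a ∷ A) [] refl x≡ refl y≡ A∩y=∅ =
      meet-cycle (_ ∷ a ∷ A) [] x≡ y≡ A∩y=∅ (s≤s (s≤s (s≤s z≤n))) (λ _ LA → R-sym r ∷ LA)
    cycle-from-edge r _ _ (_ ∷ A) (_ ∷ B) refl x≡ refl y≡ A∩y=∅ =
      meet-cycle (_ ∷ A) (_ ∷ B) x≡ y≡ A∩y=∅ (s≤s (s≤s (≤-trans (s≤s z≤n) (m≤n+m (suc (length A)) (length B)))))
        (λ LB LA → join-at B LB (R-sym r) LA)

    parent-edge : ∀ {x y} → R x y → (x ≢ ρ × par x ≡ y) ⊎ (y ≢ ρ × par y ≡ x)
    parent-edge {x} {y} r with ¬? (x ≟ ρ) ×-dec (par x ≟ y)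
    ... | yes x→y = inj₁ x→y
    ... | no ¬x→y with ¬? (y ≟ ρ) ×-dec (par y ≟ x)
    ...   | yes y→x = inj₂ y→x
    ...   | no ¬y→x with split-at-first (_∈? rootPath y) (lose (root∈chain (depth x) x ≤-refl) (root∈chain (depth y) y ≤-refl))
    ...     | A , c , ax , x≡ , A∩y=∅ , c∈y with ∈-∃++ c∈y | chain-head (depth x) x | chain-head (depth y) y
    ...       | B , by , y≡ | rx , x∷rx | ry , y∷ry =
      ⊥-elim (acyclic (cycle-from-edge r ¬x→y ¬y→x A B (trans (sym x∷rx) x≡) x≡ (trans (sym y∷ry) y≡) y≡ A∩y=∅))

module Closure {V : Set} (_≟_ : DecidableEquality V) (vertices : List V) (complete : ∀ v → v ∈ vertices)
               (Arc : V → V → Set) (Arc? : ∀ x y → Dec (Arc x y))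
               (Good : V → Set) (Good? : ∀ v → Dec (Good v)) (u : V) (good-u : Good u) where

  open import Data.List.Membership.DecPropositional _≟_ using (_∈?_)

  Step : V → V → Set
  Step x y = Arc x y × Good y

  -- BackPath x P: P is a Step-path from u to x, listed backwards (x first, u last).
  data BackPath : V → List V → Set where
    start : BackPath u [ u ]
    ext   : ∀ {x y P} → Step x y → BackPath x P → BackPath y (y ∷ P)

  record Reached (X : List V) : Set where
    field
      unique    : Unique X
      has-start : u ∈ X
      good      : All Good X
      path      : ∀ {x} → x ∈ X → Σ (List V) λ P → BackPath x P × Unique P × All (_∈ X) P

  Closed : List V → Set
  Closed X = ∀ {x y} → x ∈ X → Step x y → y ∈ X

  grow : ∀ {X x y} → Reached X → x ∈ X → Step x y → y ∉ X → Reached (y ∷ X)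
  grow {X} {x} {y} reached x∈X move y∉X = record
    { unique    = ¬Any⇒All¬ X y∉X ∷ unique
    ; has-start = there has-start
    ; good      = proj₂ move ∷ good
    ; path      = λ { (here refl) → extended ; (there z∈X) → weaken (path z∈X) }
    }
    where
    open Reached reached
    weaken : ∀ {z} → Σ (List V) (λ P → BackPath z P × Unique P × All (_∈ X) P) →
             Σ (List V) λ P → BackPath z P × Unique P × All (_∈ y ∷ X) P
    weaken (P , p , uP , P⊆X) = P , p , uP , All.map there P⊆X
    extended : Σ (List V) λ P → BackPath y P × Unique P × All (_∈ y ∷ X) P
    extended with path x∈X
    ... | P , p , uP , P⊆X = y ∷ P , ext move p , ¬Any⇒All¬ P (λ y∈P → y∉X (All.lookup P⊆X y∈P)) ∷ uP ,
                             here refl ∷ All.map there P⊆X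

  -- Add new vertices while possible; fuel is bounded by the pigeonhole principle,
  -- since X never exceeds the list of all vertices.
  explore : (fuel : ℕ) (X : List V) → Reached X → length vertices < length X + fuel →
            Σ (List V) λ X′ → Reached X′ × Closed X′
  explore fuel X reached bound with any? (λ x → any? (λ y → (Arc? x y ×-dec Good? y) ×-dec ¬? (y ∈? X)) vertices) X
  ... | no none = X , reached , closed
    where
    closed : Closed X
    closed {x} {y} x∈X move with y ∈? X
    ... | yes y∈X = y∈X
    ... | no  y∉X = ⊥-elim (none (lose x∈X (lose (complete y) (move , y∉X))))
  explore zero X reached bound | yes _ =
    ⊥-elim (<-irrefl refl (<-≤-trans (subst (length vertices <_) (+-identityʳ (length X)) bound)
                                      (unique⊆⇒length≤ (Reached.unique reached) λ {z} _ → complete z)))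
  explore (suc fuel) X reached bound | yes new with find new
  ... | x , x∈X , new-from-x with find new-from-x
  ...   | y , _ , move , y∉X =
    explore fuel (y ∷ X) (grow reached x∈X move y∉X) (subst (length vertices <_) (+-suc (length X) fuel) bound)

  closure : Σ (List V) λ X → Reached X × Closed X
  closure = explore (length vertices) [ u ] start-reached ≤-refl
    where
    start-reached : Reached [ u ]
    start-reached = record
      { unique = [] ∷ [] ; has-start = here refl ; good = good-u ∷ []
      ; path = λ { (here refl) → [ u ] , start , [] ∷ [] , here refl ∷ [] } }

  backPath-long : ∀ {x P} → BackPath x P → x ≢ u → 2 ≤ length P
  backPath-long start             x≢u = ⊥-elim (x≢u refl)
  backPath-long (ext _ start)     _   = s≤s (s≤s z≤n)
  backPath-long (ext _ (ext _ _)) _   = s≤s (s≤s z≤n)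

  module _ {z : V} (arc-z : Arc z u) where

    backPath-linked : ∀ {x P} → BackPath x P → Linked (flip Arc) (P ++ [ z ])
    backPath-linked-from : ∀ {x y P} → Arc x y → BackPath x P → Linked (flip Arc) (y ∷ P ++ [ z ])

    backPath-linked start        = arc-z ∷ [-]
    backPath-linked (ext move p) = backPath-linked-from (proj₁ move) p

    backPath-linked-from arc start       = arc ∷ backPath-linked start
    backPath-linked-from arc (ext move p) = arc ∷ backPath-linked (ext move p)

Edge : ℕ → ℕ → Set
Edge m r = Fin m × Fin (suc r)

neighbours : ∀ {m r} → BipGraph m r → Fin m → List (Fin (suc r))
neighbours {r = r} E i = filter (λ j → E i j Bool.≟ true) (allFin (suc r))

count-true : (f : A → Bool) (xs : List A) →
             sum (map (λ x → if f x then 1 else 0) xs) ≡ length (filter (λ x → f x Bool.≟ true) xs)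
count-true f []       = refl
count-true f (x ∷ xs) with f x
... | true  = cong suc (count-true f xs)
... | false = count-true f xs

edges : ∀ {m r} → BipGraph m r → List (Fin m) → List (Edge m r)
edges E []      = []
edges E (i ∷ L) = map (i ,_) (neighbours E i) ++ edges E L

length-edges : ∀ {m r} (E : BipGraph m r) (L : List (Fin m)) → length (edges E L) ≡ sum (map (degL E) L)
length-edges E []      = refl
length-edges {r = r} E (i ∷ L) = begin
  length (map (i ,_) (neighbours E i) ++ edges E L)       ≡⟨ length-++ (map (i ,_) (neighbours E i)) ⟩
  length (map (i ,_) (neighbours E i)) + length (edges E L) ≡⟨ cong₂ _+_ (length-map (i ,_) (neighbours E i)) (length-edges E L) ⟩
  length (neighbours E i) + sum (map (degL E) L)          ≡⟨ cong (_+ sum (map (degL E) L)) (sym (count-true (E i) (allFin (suc r)))) ⟩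
  degL E i + sum (map (degL E) L)                          ∎
  where open ≡-Reasoning

∈-edges⁺ : ∀ {m r} (E : BipGraph m r) {L i j} → i ∈ L → E i j ≡ true → (i , j) ∈ edges E L
∈-edges⁺ E {i ∷ L} {j = j} (here refl) eij = ∈-++⁺ˡ (∈-map⁺ (i ,_) (∈-filter⁺ (λ j → E i j Bool.≟ true) (∈-allFin j) eij))
∈-edges⁺ E {i ∷ L} (there i∈L) eij = ∈-++⁺ʳ (map (i ,_) (neighbours E i)) (∈-edges⁺ E i∈L eij)

∈-edges⁻ : ∀ {m r} (E : BipGraph m r) (L : List (Fin m)) {i j} → (i , j) ∈ edges E L → i ∈ L × E i j ≡ true
∈-edges⁻ E (i ∷ L) e∈ with ∈-++⁻ (map (i ,_) (neighbours E i)) e∈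
... | inj₂ e∈rest = let i∈L , eij = ∈-edges⁻ E L e∈rest in there i∈L , eij
... | inj₁ e∈here with ∈-map⁻ (i ,_) e∈here
...   | j , j∈ , refl = here refl , proj₂ (∈-filter⁻ (λ j → E i j Bool.≟ true) {xs = allFin _} j∈)

unique-edges : ∀ {m r} (E : BipGraph m r) {L} → Unique L → Unique (edges E L)
unique-edges E {[]}    _            = []
unique-edges {r = r} E {i ∷ L} (i∉L ∷ uL) =
  Unique.++⁺ (Unique.map⁺ (cong proj₂) (Unique.filter⁺ (λ j → E i j Bool.≟ true) (Unique.allFin⁺ (suc r))))
             (unique-edges E uL) disjoint
  where
  disjoint : ∀ {e} → ¬ (e ∈ map (i ,_) (neighbours E i) × e ∈ edges E L)
  disjoint (e∈here , e∈rest) with ∈-map⁻ (i ,_) e∈here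
  ... | _ , _ , refl = All¬⇒¬Any i∉L (proj₁ (∈-edges⁻ E L e∈rest))

sum-strict : (f g : A → ℕ) (L : List A) {u : A} → u ∈ L → (∀ {i} → i ∈ L → g i ≤ f i) → g u < f u →
             suc (sum (map g L)) ≤ sum (map f L)
sum-strict f g (x ∷ L) (here refl) g≤f gu<fu = +-mono-≤ gu<fu (sum-mono L (g≤f ∘ there))
  where
  sum-mono : ∀ L′ → (∀ {i} → i ∈ L′ → g i ≤ f i) → sum (map g L′) ≤ sum (map f L′)
  sum-mono []       _   = z≤n
  sum-mono (y ∷ L′) g≤f′ = +-mono-≤ (g≤f′ (here refl)) (sum-mono L′ (g≤f′ ∘ there))
sum-strict f g (x ∷ L) (there u∈L) g≤f gu<fu =
  subst (_≤ f x + sum (map f L)) (+-suc (g x) _) (+-mono-≤ (g≤f (here refl)) (sum-strict f g L u∈L (g≤f ∘ there) gu<fu))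

decrement-reflects-≤ : ∀ a b → + a ℤ.- 1ℤ ℤ.≤ + b ℤ.- 1ℤ → a ≤ b
decrement-reflects-≤ zero    b       _          = z≤n
decrement-reflects-≤ (suc a) zero    ()
decrement-reflects-≤ (suc a) (suc b) (ℤ.+≤+ a≤b) = s≤s a≤b

decrement-reflects-< : ∀ a b → + a ℤ.- 1ℤ ℤ.< + b ℤ.- 1ℤ → a < b
decrement-reflects-< zero    zero    (ℤ.-<- ())
decrement-reflects-< zero    (suc b) _          = s≤s z≤n
decrement-reflects-< (suc a) zero    ()
decrement-reflects-< (suc a) (suc b) (ℤ.+<+ a<b) = s≤s a<b

module Incompatibility {m r : ℕ} {G T T′ : BipGraph m r} (spanning-T : IsSpanningTree G T) (spanning-T′ : IsSpanningTree G T′)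
                       (u w : Fin m) (u≢w : u ≢ w) (T′u0 : T′ u zero ≡ true) (Tw0 : T w zero ≡ true) where

  V : Set
  V = Vertex m r

  _≟V_ : DecidableEquality V
  _≟V_ = ≡-dec Fin._≟_ Fin._≟_

  open import Data.List.Membership.DecPropositional _≟V_ using (_∈?_)

  vertices : List V
  vertices = map inj₁ (allFin m) ++ map inj₂ (allFin (suc r))

  complete : ∀ v → v ∈ vertices
  complete (inj₁ i) = ∈-++⁺ˡ (∈-map⁺ inj₁ (∈-allFin i))
  complete (inj₂ j) = ∈-++⁺ʳ (map inj₁ (allFin m)) (∈-map⁺ inj₂ (∈-allFin j))

  adj? : (E : BipGraph m r) → ∀ x y → Dec (Adj E x y)
  adj? E (inj₁ i) (inj₂ j) = E i j Bool.≟ true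
  adj? E (inj₂ j) (inj₁ i) = E i j Bool.≟ true
  adj? E (inj₁ _) (inj₁ _) = no λ ()
  adj? E (inj₂ _) (inj₂ _) = no λ ()

  adj-sym : ∀ {E : BipGraph m r} {x y} → Adj E x y → Adj E y x
  adj-sym {x = inj₁ _} {inj₂ _} e = e
  adj-sym {x = inj₂ _} {inj₁ _} e = e

  adj-irrefl : ∀ {E : BipGraph m r} {x} → ¬ Adj E x x
  adj-irrefl {x = inj₁ _} ()
  adj-irrefl {x = inj₂ _} ()

  arc? : ∀ x y → Dec (Arc T T′ x y)
  arc? (inj₁ i) (inj₂ j) = T i j Bool.≟ true
  arc? (inj₂ j) (inj₁ i) = T′ i j Bool.≟ true
  arc? (inj₁ _) (inj₁ _) = no λ ()
  arc? (inj₂ _) (inj₂ _) = no λ ()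

  -- The edge with endpoints x and y; only used for adjacent x, y, so the values
  -- on same-side pairs are immaterial.
  ends : V → V → Edge m r
  ends (inj₁ i) (inj₂ j) = i , j
  ends (inj₂ j) (inj₁ i) = i , j
  ends (inj₁ i) (inj₁ _) = i , zero
  ends (inj₂ j) (inj₂ _) = u , j

  ends-adj : ∀ {E : BipGraph m r} {x y} → Adj E x y → E (proj₁ (ends x y)) (proj₂ (ends x y)) ≡ true
  ends-adj {x = inj₁ _} {inj₂ _} e = e
  ends-adj {x = inj₂ _} {inj₁ _} e = e

  ends-inj : ∀ {E E′ : BipGraph m r} {x y x′ y′} → Adj E x y → Adj E′ x′ y′ → ends x y ≡ ends x′ y′ →
             (x ≡ x′ × y ≡ y′) ⊎ (x ≡ y′ × y ≡ x′)
  ends-inj {x = inj₁ _} {inj₂ _} {inj₁ _} {inj₂ _} _ _ refl = inj₁ (refl , refl)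
  ends-inj {x = inj₁ _} {inj₂ _} {inj₂ _} {inj₁ _} _ _ refl = inj₂ (refl , refl)
  ends-inj {x = inj₂ _} {inj₁ _} {inj₁ _} {inj₂ _} _ _ refl = inj₂ (refl , refl)
  ends-inj {x = inj₂ _} {inj₁ _} {inj₂ _} {inj₁ _} _ _ refl = inj₁ (refl , refl)

  ρ : V
  ρ = inj₂ zero

  module RootedT  = Rooted _≟V_ vertices complete (Adj T)  (adj? T)  ρ (proj₁ (proj₂ spanning-T)  ρ)
  module RootedT′ = Rooted _≟V_ vertices complete (Adj T′) (adj? T′) ρ (proj₁ (proj₂ spanning-T′) ρ)
  open RootedT.Acyclic adj-sym adj-irrefl (proj₂ (proj₂ spanning-T)) using (parent-edge)

  Avoids : V → Set
  Avoids v = v ≢ inj₁ w × v ≢ ρ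

  module Reach = Closure _≟V_ vertices complete (Arc T T′) arc? Avoids (λ v → ¬? (v ≟V inj₁ w) ×-dec ¬? (v ≟V ρ))
                         (inj₁ u) ((λ u≡w → u≢w (inj₁-injective u≡w)) , λ ())

  X : List V
  X = proj₁ Reach.closure

  reached : Reach.Reached X
  reached = proj₁ (proj₂ Reach.closure)

  closed : Reach.Closed X
  closed = proj₂ (proj₂ Reach.closure)

  avoids : ∀ {v} → v ∈ X → Avoids v
  avoids v∈X = All.lookup (Reach.Reached.good reached) v∈X

  -- Case 1: if some right vertex j ∈ X is a T'-neighbour of w, then
  -- w →T 0' →T' u ⇝ j →T' w is a directed cycle of length ≥ 4 in U(T,T').
  cycle-through-root : ∀ j → inj₂ j ∈ X → T′ w j ≡ true → Incompatible T T′
  cycle-through-root j j∈X T′wj with Reach.Reached.path reached j∈X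
  ... | P , path , unique-P , P⊆X = cycle-flip 4 (ρ , inj₁ w ∷ P , long , unique , linked)
    where
    linked : Linked (flip (Arc T T′)) ((ρ ∷ inj₁ w ∷ P) ++ [ ρ ])
    linked = Tw0 ∷ Reach.backPath-linked-from T′u0 T′wj path
    long : 4 ≤ length (ρ ∷ inj₁ w ∷ P)
    long = s≤s (s≤s (Reach.backPath-long path λ ()))
    unique : Unique (ρ ∷ inj₁ w ∷ P)
    unique = ((λ ()) ∷ ¬Any⇒All¬ P (λ ρ∈P → proj₂ (avoids (All.lookup P⊆X ρ∈P)) refl))
           ∷ ¬Any⇒All¬ P (λ w∈P → proj₁ (avoids (All.lookup P⊆X w∈P)) refl)
           ∷ unique-P

  L : List (Fin m)
  L = filter (λ i → inj₁ i ∈? X) (allFin m)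

  unique-L : Unique L
  unique-L = Unique.filter⁺ (λ i → inj₁ i ∈? X) (Unique.allFin⁺ m)

  L⊆X : ∀ {i} → i ∈ L → inj₁ i ∈ X
  L⊆X i∈L = proj₂ (∈-filter⁻ (λ i → inj₁ i ∈? X) {xs = allFin m} i∈L)

  X⊆L : ∀ {i} → inj₁ i ∈ X → i ∈ L
  X⊆L {i} i∈X = ∈-filter⁺ (λ i → inj₁ i ∈? X) (∈-allFin i) i∈X

  returns? : Dec (Any (λ j → inj₂ j ∈ X × T′ w j ≡ true) (allFin (suc r)))
  returns? = any? (λ j → (inj₂ j ∈? X) ×-dec (T′ w j Bool.≟ true)) (allFin (suc r))

  u∈L : u ∈ L
  u∈L = X⊆L (Reach.Reached.has-start reached)

  w∉L : ∀ {i} → i ∈ L → i ≢ w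
  w∉L i∈L i≡w = proj₁ (avoids (L⊆X i∈L)) (cong inj₁ i≡w)

  -- Case 2, first count: if no right vertex of X is a T'-neighbour of w, then X is
  -- closed under T'-edges towards the left, so the map sending v ∈ X to the
  -- T'-edge joining v to its T'-parent lands in the T'-edges at L; it is injective,
  -- hence |X| ≤ Σ_{i ∈ L} deg_T'(i).
  module T′-Count (no-return : ∀ j → inj₂ j ∈ X → T′ w j ≢ true) where

    left-end∈L : ∀ {x y} → x ∈ X → Adj T′ x y → proj₁ (ends x y) ∈ L
    left-end∈L {inj₁ i} {inj₂ j} i∈X _    = X⊆L i∈X
    left-end∈L {inj₂ j} {inj₁ i} j∈X T′ij = X⊆L (closed j∈X (T′ij , avoids-i))
      where
      avoids-i : Avoids (inj₁ i)
      avoids-i = (λ i≡w → no-return j j∈X (subst (λ k → T′ k j ≡ true) (inj₁-injective i≡w) T′ij)) , λ ()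

    edge-to-parent : V → Edge m r
    edge-to-parent v = ends v (RootedT′.par v)

    parent-adj : ∀ {v} → v ∈ X → Adj T′ v (RootedT′.par v)
    parent-adj v∈X = adj-sym (RootedT′.par-adjacent (proj₂ (avoids v∈X)))

    edge-to-parent-inj : ∀ {v v′} → v ∈ X → v′ ∈ X → edge-to-parent v ≡ edge-to-parent v′ → v ≡ v′
    edge-to-parent-inj v∈X v′∈X eq with ends-inj (parent-adj v∈X) (parent-adj v′∈X) eq
    ... | inj₁ (v≡v′ , _)        = v≡v′
    ... | inj₂ (v≡pv′ , pv≡v′) =
      ⊥-elim (RootedT′.no-parent-swap (proj₂ (avoids v∈X)) (proj₂ (avoids v′∈X)) pv≡v′ (sym v≡pv′))

    X≤edges : length X ≤ length (edges T′ L)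
    X≤edges = injection⇒length≤ edge-to-parent (Reach.Reached.unique reached) edge-to-parent-inj
      λ v∈X → ∈-edges⁺ T′ (left-end∈L v∈X (parent-adj v∈X)) (ends-adj (parent-adj v∈X))

  -- Case 2, second count: every T-edge is a parent edge, so it is determined by its
  -- endpoint farther from 0', its child.  The T-edges at L, together with w0',
  -- have their children in {w} ∪ X, hence Σ_{i ∈ L} deg_T(i) ≤ |X|.
  child : Edge m r → V
  child (i , j) with RootedT.par (inj₁ i) ≟V inj₂ j
  ... | yes _ = inj₁ i
  ... | no  _ = inj₂ j

  child-spec : ∀ {i j} → T i j ≡ true →
               (child (i , j) ≡ inj₁ i × RootedT.par (inj₁ i) ≡ inj₂ j) ⊎
               (child (i , j) ≡ inj₂ j × inj₂ j ≢ ρ × RootedT.par (inj₂ j) ≡ inj₁ i)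
  child-spec {i} {j} Tij with RootedT.par (inj₁ i) ≟V inj₂ j
  ... | yes p≡j = inj₁ (refl , p≡j)
  ... | no  p≢j with parent-edge {inj₁ i} {inj₂ j} Tij
  ...   | inj₁ (_ , p≡j)    = ⊥-elim (p≢j p≡j)
  ...   | inj₂ (j≢ρ , p≡i) = inj₂ (refl , j≢ρ , p≡i)

  child-parent-edge : ∀ {i j} → T i j ≡ true → ends (child (i , j)) (RootedT.par (child (i , j))) ≡ (i , j)
  child-parent-edge {i} {j} Tij with child-spec Tij
  ... | inj₁ (c≡i , p≡j)     = trans (cong (λ c → ends c (RootedT.par c)) c≡i) (cong (ends (inj₁ i)) p≡j)
  ... | inj₂ (c≡j , _ , p≡i) = trans (cong (λ c → ends c (RootedT.par c)) c≡j) (cong (ends (inj₂ j)) p≡i)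

  T-edges : List (Edge m r)
  T-edges = (w , zero) ∷ edges T L

  T-edge : ∀ {e} → e ∈ T-edges → T (proj₁ e) (proj₂ e) ≡ true
  T-edge (here refl) = Tw0
  T-edge (there e∈)  = proj₂ (∈-edges⁻ T L e∈)

  child-inj : ∀ {e e′} → e ∈ T-edges → e′ ∈ T-edges → child e ≡ child e′ → e ≡ e′
  child-inj e∈ e′∈ eq = trans (sym (child-parent-edge (T-edge e∈)))
                              (trans (cong (λ c → ends c (RootedT.par c)) eq) (child-parent-edge (T-edge e′∈)))

  -- Children of these edges lie in {w} ∪ X, by closure of X under T-edges to the right.
  child∈ : ∀ {e} → e ∈ T-edges → child e ∈ inj₁ w ∷ X
  child∈ (here refl) with child-spec Tw0
  ... | inj₁ (c≡w , _)      = here c≡w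
  ... | inj₂ (_ , 0≢ρ , _) = ⊥-elim (0≢ρ refl)
  child∈ {i , j} (there e∈) with ∈-edges⁻ T L e∈ | child-spec (proj₂ (∈-edges⁻ T L e∈))
  ... | i∈L , _   | inj₁ (c≡i , _)       = there (subst (_∈ X) (sym c≡i) (L⊆X i∈L))
  ... | i∈L , Tij | inj₂ (c≡j , j≢ρ , _) = there (subst (_∈ X) (sym c≡j) (closed (L⊆X i∈L) (Tij , (λ ()) , j≢ρ)))

  edges≤X : length (edges T L) ≤ length X
  edges≤X = s≤s⁻¹ (injection⇒length≤ child unique-T-edges child-inj child∈)
    where
    unique-T-edges : Unique T-edges
    unique-T-edges = ¬Any⇒All¬ (edges T L) (λ w∈ → w∉L (proj₁ (∈-edges⁻ T L w∈)) refl) ∷ unique-edges T unique-L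

mainTheorem10 : (m r : ℕ) (G T T' : BipGraph m r) →
    NoIsolated G → IsSpanningTree G T → IsSpanningTree G T' →
    (u w : Fin m) → ¬ (u ≡ w) →
    leftDeg T w ℤ.< leftDeg T' w →
    leftDeg T u ℤ.> leftDeg T' u →
    (∀ i → ¬ (i ≡ w) → leftDeg T i ℤ.≥ leftDeg T' i) →
    T' u zero ≡ true → T' w zero ≡ true → T w zero ≡ true →
    Incompatible T T'
mainTheorem10 m r G T T' _ spanning-T spanning-T' u w u≢w _ u-drops others-keep T'u0 _ Tw0 =
  case returns? of λ where
    (yes found) → let j , j∈X , T'wj = satisfied found in cycle-through-root j j∈X T'wj
    (no none)   → ⊥-elim (<-irrefl refl (begin-strict
      sum (map (degL T') L) <⟨ degree-gap ⟩
      sum (map (degL T) L)  ≡⟨ sym (length-edges T L) ⟩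
      length (edges T L)    ≤⟨ edges≤X ⟩
      length X              ≤⟨ T′-Count.X≤edges (λ j j∈X T'wj → none (lose (∈-allFin j) (j∈X , T'wj))) ⟩
      length (edges T' L)   ≡⟨ length-edges T' L ⟩
      sum (map (degL T') L) ∎))
  where
  open Incompatibility spanning-T spanning-T' u w u≢w T'u0 Tw0
  open ≤-Reasoning
  degree-gap : sum (map (degL T') L) < sum (map (degL T) L)
  degree-gap = sum-strict (degL T) (degL T') L u∈L
    (λ {i} i∈L → decrement-reflects-≤ _ _ (others-keep i (w∉L i∈L))) (decrement-reflects-< _ _ u-drops)
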